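{- Let $n$ and $d$ be positive integers. Suppose there is a prime $q$ with $n/(d+1)<q<n/d$ and a prime power $p^a$ ($p$ prime, $a\ge1$) dividing $n$ with $n-dq<p^a$. Then $n$ satisfies the $N$-variation of Condition 1 with $N=2+\lfloor d/2\rfloor$.
   Context: A positive integer $n$ satisfies the $N$-variation of Condition 1 if there exist $N$ distinct primes such that for every $k$ with $1\le k\le n-1$, $\binom{n}{k}$ is divisible by at least one of them. -}

module Defs where

open import Data.Nat using (ℕ; suc; _≤_; _<_; _+_)
open import Data.Nat.Divisibility using (_∣_)
open import Data.Nat.Primality using (Prime)
open import Data.Nat.Combinatorics using (_C_)
open import Data.List using (List; length)
open import Data.List.Relation.Unary.All using (All)
open import Data.List.Relation.Unary.Any using (Any)
open import Data.List.Relation.Unary.Unique.Propositional using (Unique)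
open import Data.Product using (∃; _×_)
open import Relation.Binary.PropositionalEquality using (_≡_)

Condition1 : ℕ → ℕ → Set
Condition1 N n =
  ∃ λ (ps : List ℕ) →
    length ps ≡ N × Unique ps × All Prime ps ×
    (∀ k → 1 ≤ k → k < n → Any (λ p → p ∣ n C k) ps)

module Submission where

-- Let n = r + d·q with r < q, and let P = p^a be a prime power with
-- P ∣ n and r < P.  Write h = ⌊d/2⌋.  Every k with 1 ≤ k < n is written
-- k = s + j·q with s = k mod q, and then one of the following happens:
--   * s > r: the q-adic digit of k exceeds that of n, so q ∣ C(n,k);
--   * P ∤ k: since P ∣ n, the identity k·C(n,k) = n·C(n-1,k-1) gives p ∣ C(n,k);
--   * s ≤ r and P ∣ k: then k is the unique multiple of P in the "block"
--     [j·q, j·q + r], and 1 ≤ j.  The same holds for n - k in block d - j,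
--     so replacing k by n - k if necessary we may assume j ≤ h; hence
--     C(n,k) = C(n, m_j), where m_j is the multiple of P in block j.
-- Adding to p and q one new prime dividing each C(n, m_j) ≠ 1 (or any fresh
-- prime, by Euclid, if it is already covered) gives 2 + h distinct primes.

open import Defs
open import Data.Nat
  using (ℕ; zero; suc; _≤_; _<_; _+_; _*_; _∸_; _^_; _/_; _%_; _!; _≟_; _≤?_; _<?_;
         NonZero; >-nonZero; ≢-nonZero⁻¹; z≤n; s≤s; s≤s⁻¹)
open import Data.Nat.Properties
open import Data.Nat.Divisibility
  using (_∣_; divides; _∣?_; ∣-refl; ∣-trans; ∣⇒≤; ∣1⇒≡1; ∣m⇒∣m*n; n∣m*n;
         ∣m∣n⇒∣m+n; ∣m+n∣m⇒∣n; *-monoʳ-∣; *-cancelˡ-∣; _∣0)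
open import Data.Nat.Primality
  using (Prime; euclidsLemma; prime⇒nonZero; prime[2]; ¬prime[1]; productOfPrimes≥1)
open import Data.Nat.Primality.Factorisation using (factorise)
open import Data.Nat.Combinatorics
  using (_C_; nCk≡n!/k![n-k]!; k![n∸k]!∣n!; nCk+nC[k+1]≡[n+1]C[k+1]; nCk≡nC[n∸k];
         k>n⇒nCk≡0)
open import Data.Nat.DivMod using (m/n*n≡m; m≡m%n+[m/n]*n; m%n<n; m*n/n≡m; /-monoˡ-≤; m<n*o⇒m/o<n)
open import Data.Nat.ListAction using (product)
open import Data.Nat.ListAction.Properties using (∈⇒∣product)
open import Data.Nat.Solver using (module +-*-Solver)
open import Data.List using (List; []; _∷_; length)
open import Data.List.Relation.Unary.All using (All; []; _∷_)
open import Data.List.Relation.Unary.All.Properties.Core using (¬Any⇒All¬)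
open import Data.List.Relation.Unary.Any using (Any; here; there; any?)
open import Data.List.Relation.Unary.AllPairs using ([]; _∷_)
open import Data.List.Relation.Unary.Unique.Propositional using (Unique)
open import Data.List.Relation.Binary.Subset.Propositional using (_⊆_)
open import Data.List.Membership.Propositional using (_∉_; lose)
open import Data.Product using (∃; _×_; _,_)
open import Data.Sum using (_⊎_; inj₁; inj₂)
open import Data.Empty using (⊥-elim)
open import Relation.Nullary using (¬_; yes; no; contradiction)
open import Relation.Binary.PropositionalEquality

binomial-factorials : ∀ {n k} → k ≤ n → (n C k) * (k ! * (n ∸ k) !) ≡ n !
binomial-factorials {n} {k} k≤n =
  trans (cong (_* (k ! * (n ∸ k) !)) (nCk≡n!/k![n-k]! k≤n))
        (m/n*n≡m {{k !* (n ∸ k) !≢0}} (k![n∸k]!∣n! k≤n))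

-- Absorption identity (k+1)·C(n+1,k+1) = (n+1)·C(n,k); it turns a
-- divisibility of n into one of k times C(n,k).
absorption : ∀ {n k} → k ≤ n → suc k * (suc n C suc k) ≡ suc n * (n C k)
absorption {n} {k} k≤n = *-cancelʳ-≡ _ _ (k ! * (n ∸ k) !) {{k !* (n ∸ k) !≢0}} (begin
  suc k * (suc n C suc k) * (k ! * (n ∸ k) !)
    ≡⟨ regroup (suc k) (suc n C suc k) (k !) ((n ∸ k) !) ⟩
  (suc n C suc k) * (suc k ! * (suc n ∸ suc k) !)
    ≡⟨ binomial-factorials (s≤s k≤n) ⟩
  suc n !
    ≡⟨ cong (suc n *_) (binomial-factorials k≤n) ⟨
  suc n * ((n C k) * (k ! * (n ∸ k) !))
    ≡⟨ *-assoc (suc n) (n C k) _ ⟨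
  suc n * (n C k) * (k ! * (n ∸ k) !) ∎)
  where
  open ≡-Reasoning
  open +-*-Solver
  regroup : ∀ a c f g → a * c * (f * g) ≡ c * ((a * f) * g)
  regroup = solve 4 (λ a c f g → a :* c :* (f :* g) := c :* ((a :* f) :* g)) refl

-- Binomial coefficients C(n,k) with k ≤ n are positive, as their product
-- with k!(n-k)! is n!.
binomial-positive : ∀ {n k} → k ≤ n → 0 < n C k
binomial-positive {n} {k} k≤n = n≢0⇒n>0 λ C≡0 →
  ≢-nonZero⁻¹ (n !) {{n !≢0}}
    (trans (sym (binomial-factorials k≤n)) (cong (_* (k ! * (n ∸ k) !)) C≡0))

-- For 0 < k < n, Pascal's rule writes C(n,k) as a sum of two positive terms.
binomial-≢1 : ∀ {n k} → 1 ≤ k → k < n → n C k ≢ 1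
binomial-≢1 {suc n} {suc k} _ (s≤s k<n) C≡1 =
  <⇒≢ (+-mono-≤ (binomial-positive (<⇒≤ k<n)) (binomial-positive k<n))
      (sym (trans (nCk+nC[k+1]≡[n+1]C[k+1] n k) C≡1))

primePower-∣-cancel : ∀ {p c} → Prime p → ¬ p ∣ c → ∀ a m → p ^ a ∣ m * c → p ^ a ∣ m
primePower-∣-cancel pp p∤c zero m _ = divides m (sym (*-identityʳ m))
primePower-∣-cancel {p} {c} pp p∤c (suc a) m pᵃ⁺¹∣mc
  with euclidsLemma m c pp (∣-trans (∣m⇒∣m*n (p ^ a) ∣-refl) pᵃ⁺¹∣mc)
... | inj₂ p∣c = contradiction p∣c p∤c
... | inj₁ (divides m′ refl) = subst (p * p ^ a ∣_) (*-comm p m′) (*-monoʳ-∣ p pᵃ∣m′)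
  where
  instance _ = prime⇒nonZero pp
  pᵃ∣m′ : p ^ a ∣ m′
  pᵃ∣m′ = primePower-∣-cancel pp p∤c a m′ (*-cancelˡ-∣ p
    (subst (p * p ^ a ∣_) (trans (cong (_* c) (*-comm m′ p)) (*-assoc p m′ c)) pᵃ⁺¹∣mc))

-- If p^a ∣ N but p^a ∤ K, then p ∣ C(N,K): otherwise p^a ∣ N·C(N-1,K-1)
-- = K·C(N,K) would force p^a ∣ K.
prime∣binomial : ∀ {p} → Prime p → ∀ a N K → p ^ a ∣ N → ¬ p ^ a ∣ K →
                 1 ≤ K → K ≤ N → p ∣ N C K
prime∣binomial {p} pp a (suc N) (suc K) pᵃ∣N pᵃ∤K _ (s≤s K≤N) with p ∣? (suc N C suc K)
... | yes p∣C = p∣C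
... | no p∤C = contradiction (primePower-∣-cancel pp p∤C a (suc K)
        (subst (p ^ a ∣_) (sym (absorption K≤N)) (∣m⇒∣m*n (N C K) pᵃ∣N))) pᵃ∤K

¬∣-residue : ∀ {q S} K → 0 < S → S < q → ¬ q ∣ S + K * q
¬∣-residue {q} {S} K 0<S S<q q∣S+Kq =
  <⇒≱ S<q (∣⇒≤ {{>-nonZero 0<S}} (∣m+n∣m⇒∣n (subst (q ∣_) (+-comm S (K * q)) q∣S+Kq) (n∣m*n K)))

-- Induction on R via Pascal's rule; the base case R = 0 is prime∣binomial.
residue-binomial : ∀ {q} → Prime q → ∀ R Q S K → R < S → S < q →
                   q ∣ (R + Q * q) C (S + K * q)
residue-binomial {q} pq zero Q S K 0<S S<q with S + K * q ≤? Q * q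
... | yes ≤Qq = prime∣binomial pq 1 (Q * q) (S + K * q)
                  (subst (_∣ Q * q) (sym (*-identityʳ q)) (n∣m*n Q))
                  (λ q¹∣ → ¬∣-residue K 0<S S<q (subst (_∣ S + K * q) (*-identityʳ q) q¹∣))
                  (≤-trans 0<S (m≤m+n S (K * q))) ≤Qq
... | no ≰Qq = subst (q ∣_) (sym (k>n⇒nCk≡0 (≰⇒> ≰Qq))) (q ∣0)
residue-binomial {q} pq (suc R) Q (suc S) K (s≤s R<S) S<q =
  subst (q ∣_) (nCk+nC[k+1]≡[n+1]C[k+1] (R + Q * q) (S + K * q))
    (∣m∣n⇒∣m+n (residue-binomial pq R Q S K R<S (<-trans (n<1+n S) S<q))
               (residue-binomial pq R Q (suc S) K (m<n⇒m<1+n R<S) S<q))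

primeDivisor : ∀ t → t ≢ 1 → ∃ λ x → Prime x × x ∣ t
primeDivisor zero _ = 2 , prime[2] , (2 ∣0)
primeDivisor (suc t) t≢1 with factorise (suc t)
... | record { factors = [] ; isFactorisation = eq } = ⊥-elim (t≢1 eq)
... | record { factors = x ∷ xs ; isFactorisation = eq ; factorsPrime = px ∷ _ } =
  x , px , subst (x ∣_) (sym eq) (∣m⇒∣m*n (product xs) ∣-refl)

-- Euclid: a prime factor of 1 + ∏ L is a prime outside L.
freshPrime : ∀ {L} → All Prime L → ∃ λ x → Prime x × x ∉ L
freshPrime {L} primes
  with primeDivisor (suc (product L)) (λ eq → <⇒≢ (s≤s (productOfPrimes≥1 primes)) (sym eq))
... | x , px , x∣1+∏ = x , px , λ x∈L →
  ¬prime[1] (subst Prime (∣1⇒≡1 (∣m+n∣m⇒∣n (subst (x ∣_) (+-comm 1 (product L)) x∣1+∏)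
                                           (∈⇒∣product x∈L))) px)

coveringStep : ∀ {L} → All Prime L → ∀ t →
               ∃ λ x → Prime x × x ∉ L × (t ≢ 1 → Any (_∣ t) (x ∷ L))
coveringStep {L} primes t with any? (_∣? t) L | t ≟ 1
... | yes covered | _ = let (x , px , x∉L) = freshPrime primes in x , px , x∉L , λ _ → there covered
... | no _ | yes t≡1 = let (x , px , x∉L) = freshPrime primes in x , px , x∉L , λ t≢1 → ⊥-elim (t≢1 t≡1)
... | no uncovered | no t≢1 = let (x , px , x∣t) = primeDivisor t t≢1 in
  x , px , (λ x∈L → uncovered (lose x∈L x∣t)) , λ _ → here x∣t

coveringPrimes : (T : ℕ → ℕ) (L : List ℕ) → Unique L → All Prime L → ∀ m →
  ∃ λ L′ → length L′ ≡ length L + m × Unique L′ × All Prime L′ × L ⊆ L′ ×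
           (∀ i → 1 ≤ i → i ≤ m → T i ≢ 1 → Any (_∣ T i) L′)
coveringPrimes T L distinct primes zero =
  L , sym (+-identityʳ _) , distinct , primes , (λ x∈L → x∈L) ,
  λ i 1≤i i≤0 _ → ⊥-elim (<⇒≱ 1≤i i≤0)
coveringPrimes T L distinct primes (suc m) with coveringPrimes T L distinct primes m
... | L′ , len , distinct′ , primes′ , L⊆L′ , covers
  with coveringStep primes′ (T (suc m))
... | x , px , x∉L′ , coversT =
  x ∷ L′ , trans (cong suc len) (sym (+-suc (length L) m)) , ¬Any⇒All¬ L′ x∉L′ ∷ distinct′ ,
  px ∷ primes′ , (λ y∈L → there (L⊆L′ y∈L)) , covers′
  where
  covers′ : ∀ i → 1 ≤ i → i ≤ suc m → T i ≢ 1 → Any (_∣ T i) (x ∷ L′)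
  covers′ i 1≤i i≤1+m Ti≢1 with m≤n⇒m<n∨m≡n i≤1+m
  ... | inj₁ (s≤s i≤m) = there (covers i 1≤i i≤m Ti≢1)
  ... | inj₂ refl = coversT Ti≢1

largestMultiple : ∀ {P m y} .{{_ : NonZero P}} → P ∣ m → m ≤ y → y < m + P → y / P * P ≡ m
largestMultiple {P} {y = y} (divides u refl) m≤y y<m+P =
  cong (_* P) (≤-antisym (s≤s⁻¹ y/P<1+u) u≤y/P)
  where
  u≤y/P : u ≤ y / P
  u≤y/P = subst (_≤ y / P) (m*n/n≡m u P) (/-monoˡ-≤ P m≤y)
  y/P<1+u : y / P < suc u
  y/P<1+u = m<n*o⇒m/o<n (subst (y <_) (+-comm (u * P) P) y<m+P)

∣-∸ : ∀ {P m k} → k ≤ m → P ∣ m → P ∣ k → P ∣ m ∸ k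
∣-∸ k≤m P∣m P∣k = ∣m+n∣m⇒∣n (subst (_ ∣_) (sym (m+[n∸m]≡n k≤m)) P∣m) P∣k

≤-double-half : ∀ d → d ≤ suc (d / 2 + d / 2)
≤-double-half d = begin
  d                       ≡⟨ m≡m%n+[m/n]*n d 2 ⟩
  d % 2 + d / 2 * 2       ≤⟨ +-monoˡ-≤ (d / 2 * 2) (s≤s⁻¹ (m%n<n d 2)) ⟩
  1 + d / 2 * 2           ≡⟨ cong suc (*-comm (d / 2) 2) ⟩
  1 + 2 * (d / 2)         ≡⟨ cong (λ x → suc (d / 2 + x)) (+-identityʳ (d / 2)) ⟩
  suc (d / 2 + d / 2)     ∎
  where open ≤-Reasoning

-- p and q are distinct: otherwise q ∣ p^a ∣ r + d·q would give q ∣ r,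
-- impossible for 0 < r < q.
distinctPrimes : ∀ {p q r d} a → 1 ≤ a → 0 < r → r < q → p ^ a ∣ r + d * q → p ≢ q
distinctPrimes {d = d} (suc a) _ 0<r r<q pᵃ∣n refl =
  ¬∣-residue d 0<r r<q (∣-trans (∣m⇒∣m*n _ ∣-refl) pᵃ∣n)

module Blocks (p a q d r : ℕ) (pp : Prime p) (pq : Prime q)
              (r<q : r < q) (r<P : r < p ^ a) (P∣n : p ^ a ∣ r + d * q) where

  P n h : ℕ
  P = p ^ a
  n = r + d * q
  h = d / 2

  instance
    q≢0 : NonZero q
    q≢0 = prime⇒nonZero pq
    P≢0 : NonZero P
    P≢0 = m^n≢0 p a {{prime⇒nonZero pp}}

  data InBlock : ℕ → ℕ → Set where
    inBlock : ∀ s j → s ≤ r → InBlock (s + j * q) j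

  -- The largest multiple of P not exceeding the end of block j; since r < P,
  -- it is the only multiple of P that block j can contain.
  blockPoint : ℕ → ℕ
  blockPoint j = (r + j * q) / P * P

  blockPoint-unique : ∀ {k j} → InBlock k j → P ∣ k → blockPoint j ≡ k
  blockPoint-unique (inBlock s j s≤r) P∣k =
    largestMultiple P∣k (+-monoˡ-≤ (j * q) s≤r) (begin-strict
      r + j * q        <⟨ +-monoˡ-< (j * q) r<P ⟩
      P + j * q        ≤⟨ +-monoʳ-≤ P (m≤n+m (j * q) s) ⟩
      P + (s + j * q)  ≡⟨ +-comm P (s + j * q) ⟩
      s + j * q + P    ∎)
    where open ≤-Reasoning

  -- Block 0 contains no positive multiple of P, because r < P.
  level-positive : ∀ {k j} → InBlock k j → P ∣ k → 1 ≤ k → 1 ≤ j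
  level-positive (inBlock s (suc j) _) _ _ = s≤s z≤n
  level-positive (inBlock s zero s≤r) P∣k 1≤k =
    ⊥-elim (<⇒≱ (≤-<-trans (subst (_≤ r) (sym (+-identityʳ s)) s≤r) r<P)
                (∣⇒≤ {{>-nonZero 1≤k}} P∣k))

  -- Numbers below n lie in blocks 0, …, d, because r < q.
  level-≤d : ∀ {k j} → InBlock k j → k < n → j ≤ d
  level-≤d (inBlock s j _) k<n = s≤s⁻¹ (*-cancelʳ-< q j (suc d) (begin-strict
    j * q      ≤⟨ m≤n+m (j * q) s ⟩
    s + j * q  <⟨ k<n ⟩
    r + d * q  <⟨ +-monoˡ-< (d * q) r<q ⟩
    q + d * q  ∎))
    where open ≤-Reasoning

  mirror : ∀ {k j} → InBlock k j → k < n → InBlock (n ∸ k) (d ∸ j)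
  mirror {k} b@(inBlock s j s≤r) k<n =
    subst (λ m → InBlock m (d ∸ j)) (sym n-k≡) (inBlock (r ∸ s) (d ∸ j) (m∸n≤m r s))
    where
    open ≡-Reasoning
    open +-*-Solver
    regroup : ∀ x y z w v → (x + y) + (z + w) * v ≡ (x + z * v) + (y + w * v)
    regroup = solve 5 (λ x y z w v → (x :+ y) :+ ((z :+ w) :* v)
                                    := (x :+ (z :* v)) :+ (y :+ (w :* v))) refl
    n-k≡ : n ∸ k ≡ r ∸ s + (d ∸ j) * q
    n-k≡ = +-cancelʳ-≡ k _ _ (begin
      n ∸ k + k                            ≡⟨ m∸n+n≡m (<⇒≤ k<n) ⟩
      r + d * q                            ≡⟨ cong₂ (λ x y → x + y * q)
                                                (m∸n+n≡m s≤r) (m∸n+n≡m (level-≤d b k<n)) ⟨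
      (r ∸ s + s) + (d ∸ j + j) * q        ≡⟨ regroup (r ∸ s) s (d ∸ j) j q ⟩
      (r ∸ s + (d ∸ j) * q) + (s + j * q)  ∎)

  -- A positive multiple k < n of P lying in a block has the same binomial
  -- coefficient as the block point of some block 1 ≤ i ≤ h: take k itself,
  -- or its mirror n - k when k lies in the upper half.
  blockCase : ∀ {k j} → 1 ≤ k → k < n → InBlock k j → P ∣ k →
              ∃ λ i → 1 ≤ i × i ≤ h × n C k ≡ n C blockPoint i
  blockCase {k} {j} 1≤k k<n b P∣k with j ≤? h
  ... | yes j≤h = j , level-positive b P∣k 1≤k , j≤h , cong (n C_) (sym (blockPoint-unique b P∣k))
  ... | no j≰h = d ∸ j , level-positive b′ P∣n-k (m<n⇒0<n∸m k<n) , d-j≤h ,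
        trans (nCk≡nC[n∸k] (<⇒≤ k<n)) (cong (n C_) (sym (blockPoint-unique b′ P∣n-k)))
    where
    b′ : InBlock (n ∸ k) (d ∸ j)
    b′ = mirror b k<n
    P∣n-k : P ∣ n ∸ k
    P∣n-k = ∣-∸ (<⇒≤ k<n) P∣n P∣k
    d-j≤h : d ∸ j ≤ h
    d-j≤h = m≤n+o⇒m∸n≤o d j (≤-trans (≤-double-half d) (+-monoˡ-≤ h (≰⇒> j≰h)))

  classify : ∀ {k} → 1 ≤ k → k < n →
             p ∣ n C k ⊎ q ∣ n C k ⊎ ∃ λ i → 1 ≤ i × i ≤ h × n C k ≡ n C blockPoint i
  classify {k} 1≤k k<n with r <? k % q | P ∣? k
  ... | yes r<s | _ = inj₂ (inj₁ (subst (λ x → q ∣ n C x) (sym (m≡m%n+[m/n]*n k q))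
          (residue-binomial pq r d (k % q) (k / q) r<s (m%n<n k q))))
  ... | no _ | no P∤k = inj₁ (prime∣binomial pp a n k P∣n P∤k 1≤k (<⇒≤ k<n))
  ... | no r≮s | yes P∣k =
          inj₂ (inj₂ (blockCase 1≤k k<n
            (subst (λ m → InBlock m (k / q)) (sym (m≡m%n+[m/n]*n k q))
                   (inBlock (k % q) (k / q) (≮⇒≥ r≮s))) P∣k))

  condition1 : p ≢ q → Condition1 (2 + h) n
  condition1 p≢q
    with coveringPrimes (λ i → n C blockPoint i) (p ∷ q ∷ []) ((p≢q ∷ []) ∷ [] ∷ []) (pp ∷ pq ∷ []) h
  ... | L , len , distinct , primes , pq⊆L , covers = L , len , distinct , primes , covered
    where
    covered : ∀ k → 1 ≤ k → k < n → Any (_∣ n C k) L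
    covered k 1≤k k<n with classify 1≤k k<n
    ... | inj₁ p∣C = lose (pq⊆L (here refl)) p∣C
    ... | inj₂ (inj₁ q∣C) = lose (pq⊆L (there (here refl))) q∣C
    ... | inj₂ (inj₂ (i , 1≤i , i≤h , C≡)) = subst (λ c → Any (_∣ c) L) (sym C≡)
            (covers i 1≤i i≤h (subst (_≢ 1) C≡ (binomial-≢1 1≤k k<n)))

proposition4p3 : (n d q p a : ℕ) → 1 ≤ n → 1 ≤ d →
    Prime q → n < (d + 1) * q → d * q < n →
    Prime p → 1 ≤ a → p ^ a ∣ n → n ∸ d * q < p ^ a →
    Condition1 (2 + d / 2) n
proposition4p3 n d q p a _ _ pq n<[d+1]q dq<n pp 1≤a pᵃ∣n r<pᵃ =
  subst (Condition1 (2 + d / 2)) r+dq≡n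
    (Blocks.condition1 p a q d r pp pq r<q r<pᵃ pᵃ∣r+dq (distinctPrimes {d = d} a 1≤a 0<r r<q pᵃ∣r+dq))
  where
  r : ℕ
  r = n ∸ d * q
  r+dq≡n : r + d * q ≡ n
  r+dq≡n = m∸n+n≡m (<⇒≤ dq<n)
  pᵃ∣r+dq : p ^ a ∣ r + d * q
  pᵃ∣r+dq = subst (p ^ a ∣_) (sym r+dq≡n) pᵃ∣n
  0<r : 0 < r
  0<r = m<n⇒0<n∸m dq<n
  r<q : r < q
  r<q = +-cancelʳ-< (d * q) r q
          (subst₂ _<_ (sym r+dq≡n) (cong (_* q) (+-comm d 1)) n<[d+1]q)
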